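{- Let $n\ge1$. Then $\mathsf{SIE}_n$ proves $\mathrm{Ind}(X)\to\omega\subseteq X$ for each class $X$ given by an $\mathcal E_n$-formula, where $\mathrm{Ind}(X)$ means $\varnothing\in X\land\forall x\in X\,(x\cup\{x\}\in X)$.
   Context: Set theory in $\{\in\}$ with intuitionistic logic. An ordinal is a transitive set of transitive sets; $\omega$ is the class of ordinals $\alpha$ such that each element of $\alpha\cup\{\alpha\}$ is $\varnothing$ or $\gamma\cup\{\gamma\}$ for an ordinal $\gamma$. Hierarchy: $\mathcal E_0=\mathcal U_0$ are the bounded formulas; $\mathcal E(\Phi)$ is the closure of $\Phi$ under $\land,\lor$, bounded quantifiers and $\exists$; $\mathcal U(\Phi,\Psi)$ is the smallest set containing $\Phi$, closed under $\land,\lor,\forall$, bounded quantifiers, and under $\psi\to\phi$ for $\psi\in\Psi$, $\phi\in\mathcal U(\Phi,\Psi)$; $\mathcal E_n=\mathcal E(\mathcal U_{n-1})$, $\mathcal U_n=\mathcal U(\mathcal E_{n-1},\mathcal E_{n-1})$; formulas provably equivalent to such formulas count as such. $\mathsf{SIE}_n$: Extensionality, Pairing, Union, Binary Intersection, $V=\mathrm{Fin}$ (every set is in bijection with some $n\in\omega$), and Set Induction $\forall x[\forall y\in x\phi(y)\to\phi(x)]\to\forall x\phi(x)$ for $\mathcal E_n$-formulas $\phi$. -}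

module Defs where

-- First-order intuitionistic set theory in the language {∈} (with equality),
-- de Bruijn-indexed syntax (variables are natural numbers; every formula may
-- have free variables, read as parameters / implicitly universally closed),
-- a natural-deduction calculus for intuitionistic first-order logic with
-- equality, the hierarchy 𝓔ₙ/𝓤ₙ, and the theory SIEₙ.

open import Data.Nat using (ℕ; zero; suc; _+_)
open import Data.List using (List; []; _∷_; map)
open import Data.List.Membership.Propositional using (_∈_)
open import Data.Product using (Σ; _×_)
import Data.Empty as E

infixr 4 _⇒_ _⇔_
infixr 5 _∨'_
infixr 6 _∧'_
infix 7 _∈'_ _≐_

data Fm : Set where
  ⊥'        : Fm
  _∈'_ _≐_  : ℕ → ℕ → Fm
  _∧'_ _∨'_ _⇒_ : Fm → Fm → Fm
  ∀' ∃'     : Fm → Fm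

ext : (ℕ → ℕ) → ℕ → ℕ
ext ρ zero    = zero
ext ρ (suc k) = suc (ρ k)

ren : (ℕ → ℕ) → Fm → Fm
ren ρ ⊥'       = ⊥'
ren ρ (x ∈' y) = ρ x ∈' ρ y
ren ρ (x ≐ y)  = ρ x ≐ ρ y
ren ρ (φ ∧' ψ) = ren ρ φ ∧' ren ρ ψ
ren ρ (φ ∨' ψ) = ren ρ φ ∨' ren ρ ψ
ren ρ (φ ⇒ ψ)  = ren ρ φ ⇒ ren ρ ψ
ren ρ (∀' φ)   = ∀' (ren (ext ρ) φ)
ren ρ (∃' φ)   = ∃' (ren (ext ρ) φ)

wk : Fm → Fm
wk = ren suc

sub0 : ℕ → ℕ → ℕ
sub0 x zero    = x
sub0 x (suc k) = k

_[_] : Fm → ℕ → Fm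
φ [ x ] = ren (sub0 x) φ

_⇔_ : Fm → Fm → Fm
φ ⇔ ψ = (φ ⇒ ψ) ∧' (ψ ⇒ φ)

bAll bEx : ℕ → Fm → Fm
bAll x φ = ∀' (0 ∈' suc x ⇒ φ)
bEx  x φ = ∃' (0 ∈' suc x ∧' φ)

infix 2 _∣_⊢_

data _∣_⊢_ (T : Fm → Set) : List Fm → Fm → Set where
  ax   : ∀ {Γ φ} → T φ → T ∣ Γ ⊢ φ
  hyp  : ∀ {Γ φ} → φ ∈ Γ → T ∣ Γ ⊢ φ
  ⊥E   : ∀ {Γ φ} → T ∣ Γ ⊢ ⊥' → T ∣ Γ ⊢ φ
  ∧I   : ∀ {Γ φ ψ} → T ∣ Γ ⊢ φ → T ∣ Γ ⊢ ψ → T ∣ Γ ⊢ φ ∧' ψ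
  ∧E₁  : ∀ {Γ φ ψ} → T ∣ Γ ⊢ φ ∧' ψ → T ∣ Γ ⊢ φ
  ∧E₂  : ∀ {Γ φ ψ} → T ∣ Γ ⊢ φ ∧' ψ → T ∣ Γ ⊢ ψ
  ∨I₁  : ∀ {Γ φ ψ} → T ∣ Γ ⊢ φ → T ∣ Γ ⊢ φ ∨' ψ
  ∨I₂  : ∀ {Γ φ ψ} → T ∣ Γ ⊢ ψ → T ∣ Γ ⊢ φ ∨' ψ
  ∨E   : ∀ {Γ φ ψ χ} → T ∣ Γ ⊢ φ ∨' ψ → T ∣ φ ∷ Γ ⊢ χ → T ∣ ψ ∷ Γ ⊢ χ → T ∣ Γ ⊢ χ
  ⇒I   : ∀ {Γ φ ψ} → T ∣ φ ∷ Γ ⊢ ψ → T ∣ Γ ⊢ φ ⇒ ψ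
  ⇒E   : ∀ {Γ φ ψ} → T ∣ Γ ⊢ φ ⇒ ψ → T ∣ Γ ⊢ φ → T ∣ Γ ⊢ ψ
  ∀I   : ∀ {Γ φ} → T ∣ map wk Γ ⊢ φ → T ∣ Γ ⊢ ∀' φ
  ∀E   : ∀ {Γ φ} → T ∣ Γ ⊢ ∀' φ → (x : ℕ) → T ∣ Γ ⊢ φ [ x ]
  ∃I   : ∀ {Γ φ} (x : ℕ) → T ∣ Γ ⊢ φ [ x ] → T ∣ Γ ⊢ ∃' φ
  ∃E   : ∀ {Γ φ ψ} → T ∣ Γ ⊢ ∃' φ → T ∣ φ ∷ map wk Γ ⊢ wk ψ → T ∣ Γ ⊢ ψ
  ≐refl  : ∀ {Γ} (x : ℕ) → T ∣ Γ ⊢ x ≐ x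
  ≐subst : ∀ {Γ φ x y} → T ∣ Γ ⊢ x ≐ y → T ∣ Γ ⊢ φ [ x ] → T ∣ Γ ⊢ φ [ y ]

NoAx : Fm → Set
NoAx _ = E.⊥

data Bounded : Fm → Set where
  ⊥b   : Bounded ⊥'
  ∈b   : ∀ x y → Bounded (x ∈' y)
  ≐b   : ∀ x y → Bounded (x ≐ y)
  ∧b   : ∀ {φ ψ} → Bounded φ → Bounded ψ → Bounded (φ ∧' ψ)
  ∨b   : ∀ {φ ψ} → Bounded φ → Bounded ψ → Bounded (φ ∨' ψ)
  ⇒b   : ∀ {φ ψ} → Bounded φ → Bounded ψ → Bounded (φ ⇒ ψ)
  bAllb : ∀ x {φ} → Bounded φ → Bounded (bAll x φ)
  bExb  : ∀ x {φ} → Bounded φ → Bounded (bEx x φ)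

data 𝓔 (Φ : Fm → Set) : Fm → Set where
  base : ∀ {φ} → Φ φ → 𝓔 Φ φ
  ∧e   : ∀ {φ ψ} → 𝓔 Φ φ → 𝓔 Φ ψ → 𝓔 Φ (φ ∧' ψ)
  ∨e   : ∀ {φ ψ} → 𝓔 Φ φ → 𝓔 Φ ψ → 𝓔 Φ (φ ∨' ψ)
  bAlle : ∀ x {φ} → 𝓔 Φ φ → 𝓔 Φ (bAll x φ)
  bExe  : ∀ x {φ} → 𝓔 Φ φ → 𝓔 Φ (bEx x φ)
  ∃e   : ∀ {φ} → 𝓔 Φ φ → 𝓔 Φ (∃' φ)

data 𝓤 (Φ Ψ : Fm → Set) : Fm → Set where
  base : ∀ {φ} → Φ φ → 𝓤 Φ Ψ φ
  ∧u   : ∀ {φ ψ} → 𝓤 Φ Ψ φ → 𝓤 Φ Ψ ψ → 𝓤 Φ Ψ (φ ∧' ψ)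
  ∨u   : ∀ {φ ψ} → 𝓤 Φ Ψ φ → 𝓤 Φ Ψ ψ → 𝓤 Φ Ψ (φ ∨' ψ)
  ∀u   : ∀ {φ} → 𝓤 Φ Ψ φ → 𝓤 Φ Ψ (∀' φ)
  bAllu : ∀ x {φ} → 𝓤 Φ Ψ φ → 𝓤 Φ Ψ (bAll x φ)
  bExu  : ∀ x {φ} → 𝓤 Φ Ψ φ → 𝓤 Φ Ψ (bEx x φ)
  ⇒u   : ∀ {ψ φ} → Ψ ψ → 𝓤 Φ Ψ φ → 𝓤 Φ Ψ (ψ ⇒ φ)

𝓔ˢ 𝓤ˢ : ℕ → Fm → Set
𝓔ˢ zero    = Bounded
𝓔ˢ (suc n) = 𝓔 (𝓤ˢ n)
𝓤ˢ zero    = Bounded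
𝓤ˢ (suc n) = 𝓤 (𝓔ˢ n) (𝓔ˢ n)

𝓔ₙ : ℕ → Fm → Set
𝓔ₙ n φ = Σ Fm (λ ψ → 𝓔ˢ n ψ × (NoAx ∣ [] ⊢ φ ⇔ ψ))

-- Defined set-theoretic formulas; arguments are variable indices in the
-- current context (shifted internally under binders).

_⊆'_ : ℕ → ℕ → Fm
x ⊆' y = bAll x (0 ∈' suc y)

isEmpty : ℕ → Fm
isEmpty x = bAll x ⊥'

isTrans : ℕ → Fm
isTrans x = bAll x (bAll 0 (0 ∈' suc (suc x)))

isOrd : ℕ → Fm
isOrd x = isTrans x ∧' bAll x (isTrans 0)

isSuccOf : ℕ → ℕ → Fm
isSuccOf b g = bAll b (0 ∈' suc g ∨' 0 ≐ suc g) ∧' bAll g (0 ∈' suc b) ∧' g ∈' b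

emptyOrSucc : ℕ → Fm
emptyOrSucc b = isEmpty b ∨' ∃' (isOrd 0 ∧' isSuccOf (suc b) 0)

-- a ∈ ω : a is an ordinal and every element of a ∪ {a} is ∅ or a successor
inω : ℕ → Fm
inω a = isOrd a ∧' bAll a (emptyOrSucc 0) ∧' emptyOrSucc a

isPair : ℕ → ℕ → ℕ → Fm
isPair w u v = bAll w (0 ≐ suc u ∨' 0 ≐ suc v) ∧' u ∈' w ∧' v ∈' w

isSingleton : ℕ → ℕ → Fm
isSingleton w u = isPair w u u

isOPair : ℕ → ℕ → ℕ → Fm
isOPair p u v =
  bAll p (isSingleton 0 (suc u) ∨' isPair 0 (suc u) (suc v))
  ∧' bEx p (isSingleton 0 (suc u))
  ∧' bEx p (isPair 0 (suc u) (suc v))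

opairIn : ℕ → ℕ → ℕ → Fm
opairIn u v f = bEx f (isOPair 0 (suc u) (suc v))

isBij : ℕ → ℕ → ℕ → Fm
isBij f x n =
  bAll f (bEx (suc x) (bEx (suc (suc n)) (isOPair 2 1 0)))
  ∧' bAll x (bEx (suc n) (opairIn 1 0 (suc (suc f))))
  ∧' bAll n (bEx (suc x) (opairIn 0 1 (suc (suc f))))
  ∧' ∀' (∀' (∀' (opairIn 2 1 (3 + f) ∧' opairIn 2 0 (3 + f) ⇒ 1 ≐ 0)))
  ∧' ∀' (∀' (∀' (opairIn 2 0 (3 + f) ∧' opairIn 1 0 (3 + f) ⇒ 2 ≐ 1)))

-- A class X given by a formula φ: variable 0 of φ is the class variable,
-- variable (suc k) of φ is the k-th parameter.  inst φ d x is "x ∈ X"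
-- written at binder depth d (relative to where the parameters live).

inst : Fm → ℕ → ℕ → Fm
inst φ d x = ren ρ φ
  where
  ρ : ℕ → ℕ
  ρ zero    = x
  ρ (suc k) = d + k

Extensionality Pairing Union Intersection VFin : Fm
Extensionality = ∀' (∀' (1 ⊆' 0 ∧' 0 ⊆' 1 ⇒ 1 ≐ 0))
Pairing        = ∀' (∀' (∃' (∀' (0 ∈' 1 ⇔ (0 ≐ 3 ∨' 0 ≐ 2)))))
Union          = ∀' (∃' (∀' (0 ∈' 1 ⇔ bEx 2 (1 ∈' 0))))
Intersection   = ∀' (∀' (∃' (∀' (0 ∈' 1 ⇔ (0 ∈' 3 ∧' 0 ∈' 2)))))
VFin           = ∀' (∃' (inω 0 ∧' ∃' (isBij 0 2 1)))

SetInd : Fm → Fm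
SetInd φ = ∀' (bAll 0 (inst φ 2 0) ⇒ inst φ 1 0) ⇒ ∀' (inst φ 1 0)

data SIE (n : ℕ) : Fm → Set where
  extensionality : SIE n Extensionality
  pairing        : SIE n Pairing
  union          : SIE n Union
  intersection   : SIE n Intersection
  vfin           : SIE n VFin
  setInduction   : ∀ φ → 𝓔ₙ n φ → SIE n (SetInd φ)

Ind : Fm → Fm
Ind φ = ∃' (isEmpty 0 ∧' inst φ 1 0)
        ∧' ∀' (inst φ 1 0 ⇒ ∃' (isSuccOf 0 1 ∧' inst φ 2 0))

ωSub : Fm → Fm
ωSub φ = ∀' (inω 0 ⇒ inst φ 1 0)

module Submission where

-- Fix a ∈ ω and prove x ∩ a ⊆ X for every x by set induction. An element y of x ∩ a is
-- either ∅, hence in X, or γ ∪ {γ}; then γ ∈ y ∩ a because a is transitive, so γ ∈ X by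
-- the induction hypothesis at y ∈ x, and y ∈ X because X is closed under successors,
-- which are unique by extensionality. Finally a itself is ∅ or a successor, and x := a
-- gives a ∩ a ⊆ X, so the same argument shows a ∈ X.

open import Defs
open import Data.Nat using (ℕ; zero; suc; _+_; _≤_)
open import Data.List using (List; []; _∷_; map)
open import Data.List.Membership.Propositional using (_∈_)
open import Data.List.Membership.Propositional.Properties using (∈-map⁺; ∈-map⁻)
open import Data.List.Relation.Binary.Subset.Propositional using (_⊆_)
open import Data.List.Relation.Unary.Any using (here; there)
open import Data.Product using (_,_)
open import Function using (id)
open import Relation.Binary.PropositionalEquality
  using (_≡_; refl; sym; trans; cong; cong₂; subst; module ≡-Reasoning)

ext-id : ∀ {ρ} → (∀ k → ρ k ≡ k) → ∀ k → ext ρ k ≡ k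
ext-id h zero    = refl
ext-id h (suc k) = cong suc (h k)

ext-fusion : ∀ {ρ σ τ} → (∀ k → ρ (σ k) ≡ τ k) → ∀ k → ext ρ (ext σ k) ≡ ext τ k
ext-fusion h zero    = refl
ext-fusion h (suc k) = cong suc (h k)

ren-id : ∀ {ρ} → (∀ k → ρ k ≡ k) → ∀ φ → ren ρ φ ≡ φ
ren-id h ⊥'       = refl
ren-id h (x ∈' y) = cong₂ _∈'_ (h x) (h y)
ren-id h (x ≐ y)  = cong₂ _≐_ (h x) (h y)
ren-id h (φ ∧' ψ) = cong₂ _∧'_ (ren-id h φ) (ren-id h ψ)
ren-id h (φ ∨' ψ) = cong₂ _∨'_ (ren-id h φ) (ren-id h ψ)
ren-id h (φ ⇒ ψ)  = cong₂ _⇒_ (ren-id h φ) (ren-id h ψ)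
ren-id h (∀' φ)   = cong ∀' (ren-id (ext-id h) φ)
ren-id h (∃' φ)   = cong ∃' (ren-id (ext-id h) φ)

ren-fusion : ∀ {ρ σ τ} → (∀ k → ρ (σ k) ≡ τ k) → ∀ φ → ren ρ (ren σ φ) ≡ ren τ φ
ren-fusion h ⊥'       = refl
ren-fusion h (x ∈' y) = cong₂ _∈'_ (h x) (h y)
ren-fusion h (x ≐ y)  = cong₂ _≐_ (h x) (h y)
ren-fusion h (φ ∧' ψ) = cong₂ _∧'_ (ren-fusion h φ) (ren-fusion h ψ)
ren-fusion h (φ ∨' ψ) = cong₂ _∨'_ (ren-fusion h φ) (ren-fusion h ψ)
ren-fusion h (φ ⇒ ψ)  = cong₂ _⇒_ (ren-fusion h φ) (ren-fusion h ψ)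
ren-fusion h (∀' φ)   = cong ∀' (ren-fusion (ext-fusion h) φ)
ren-fusion h (∃' φ)   = cong ∃' (ren-fusion (ext-fusion h) φ)

ren-cong : ∀ {ρ σ} → (∀ k → ρ k ≡ σ k) → ∀ φ → ren ρ φ ≡ ren σ φ
ren-cong {ρ} h φ = trans (cong (ren ρ) (sym (ren-id (λ _ → refl) φ))) (ren-fusion h φ)

ren-wk : ∀ ρ φ → ren (ext ρ) (wk φ) ≡ wk (ren ρ φ)
ren-wk ρ φ = trans (ren-fusion (λ _ → refl) φ) (sym (ren-fusion (λ _ → refl) φ))

ren-[] : ∀ ρ x φ → ren ρ (φ [ x ]) ≡ ren (ext ρ) φ [ ρ x ]
ren-[] ρ x φ = trans (ren-fusion (λ _ → refl) φ) (sym (ren-fusion sub0-ext φ))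
  where
  sub0-ext : ∀ k → sub0 (ρ x) (ext ρ k) ≡ ρ (sub0 x k)
  sub0-ext zero    = refl
  sub0-ext (suc k) = refl

ext-wk-[0] : ∀ φ → ren (ext suc) φ [ 0 ] ≡ φ
ext-wk-[0] φ = trans (ren-fusion (λ _ → refl) φ) (ren-id (λ { zero → refl ; (suc k) → refl }) φ)

RenClosed : (Fm → Set) → Set
RenClosed T = ∀ ρ {φ} → T φ → T (ren ρ φ)

_⊆⟨_⟩_ : List Fm → (ℕ → ℕ) → List Fm → Set
Γ ⊆⟨ ρ ⟩ Δ = ∀ {χ} → χ ∈ Γ → ren ρ χ ∈ Δ

⊆⟨⟩-∷ : ∀ {Γ Δ ρ ψ} → Γ ⊆⟨ ρ ⟩ Δ → (ψ ∷ Γ) ⊆⟨ ρ ⟩ (ren ρ ψ ∷ Δ)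
⊆⟨⟩-∷ h (here refl) = here refl
⊆⟨⟩-∷ h (there m)   = there (h m)

⊆⟨⟩-wk : ∀ {Γ Δ ρ} → Γ ⊆⟨ ρ ⟩ Δ → map wk Γ ⊆⟨ ext ρ ⟩ map wk Δ
⊆⟨⟩-wk {Δ = Δ} {ρ} h m with ∈-map⁻ wk m
... | χ , χ∈Γ , refl = subst (_∈ map wk Δ) (sym (ren-wk ρ χ)) (∈-map⁺ wk (h χ∈Γ))

cast : ∀ {T Γ φ ψ} → φ ≡ ψ → T ∣ Γ ⊢ φ → T ∣ Γ ⊢ ψ
cast refl d = d

⊢-ren : ∀ {T Γ Δ φ} → RenClosed T → ∀ ρ → Γ ⊆⟨ ρ ⟩ Δ → T ∣ Γ ⊢ φ → T ∣ Δ ⊢ ren ρ φ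
⊢-ren cl ρ h (ax t)     = ax (cl ρ t)
⊢-ren cl ρ h (hyp m)    = hyp (h m)
⊢-ren cl ρ h (⊥E d)     = ⊥E (⊢-ren cl ρ h d)
⊢-ren cl ρ h (∧I d e)   = ∧I (⊢-ren cl ρ h d) (⊢-ren cl ρ h e)
⊢-ren cl ρ h (∧E₁ d)    = ∧E₁ (⊢-ren cl ρ h d)
⊢-ren cl ρ h (∧E₂ d)    = ∧E₂ (⊢-ren cl ρ h d)
⊢-ren cl ρ h (∨I₁ d)    = ∨I₁ (⊢-ren cl ρ h d)
⊢-ren cl ρ h (∨I₂ d)    = ∨I₂ (⊢-ren cl ρ h d)
⊢-ren cl ρ h (∨E d e f) = ∨E (⊢-ren cl ρ h d) (⊢-ren cl ρ (⊆⟨⟩-∷ h) e) (⊢-ren cl ρ (⊆⟨⟩-∷ h) f)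
⊢-ren cl ρ h (⇒I d)     = ⇒I (⊢-ren cl ρ (⊆⟨⟩-∷ h) d)
⊢-ren cl ρ h (⇒E d e)   = ⇒E (⊢-ren cl ρ h d) (⊢-ren cl ρ h e)
⊢-ren cl ρ h (∀I d)     = ∀I (⊢-ren cl (ext ρ) (⊆⟨⟩-wk h) d)
⊢-ren cl ρ h (∀E {φ = φ} d x) = cast (sym (ren-[] ρ x φ)) (∀E (⊢-ren cl ρ h d) (ρ x))
⊢-ren cl ρ h (∃I {φ = φ} x d) = ∃I (ρ x) (cast (ren-[] ρ x φ) (⊢-ren cl ρ h d))
⊢-ren cl ρ h (∃E {ψ = ψ} d e) =
  ∃E (⊢-ren cl ρ h d) (cast (ren-wk ρ ψ) (⊢-ren cl (ext ρ) (⊆⟨⟩-∷ (⊆⟨⟩-wk h)) e))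
⊢-ren cl ρ h (≐refl x)  = ≐refl (ρ x)
⊢-ren cl ρ h (≐subst {φ = φ} {x} {y} e d) =
  cast (sym (ren-[] ρ y φ)) (≐subst (⊢-ren cl ρ h e) (cast (ren-[] ρ x φ) (⊢-ren cl ρ h d)))

instVar : ℕ → ℕ → ℕ → ℕ
instVar d x zero    = x
instVar d x (suc k) = d + k

inst≡ren : ∀ φ d x → inst φ d x ≡ ren (instVar d x) φ
inst≡ren φ d x = ren-cong (λ { zero → refl ; (suc k) → refl }) φ

ren-inst : ∀ σ φ {d d′ x} → (∀ k → σ (d + k) ≡ d′ + k) → ren σ (inst φ d x) ≡ inst φ d′ (σ x)
ren-inst σ φ {d} {d′} {x} h = begin
  ren σ (inst φ d x)               ≡⟨ cong (ren σ) (inst≡ren φ d x) ⟩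
  ren σ (ren (instVar d x) φ)      ≡⟨ ren-fusion commute φ ⟩
  ren (instVar d′ (σ x)) φ         ≡⟨ sym (inst≡ren φ d′ (σ x)) ⟩
  inst φ d′ (σ x)                  ∎
  where
  open ≡-Reasoning
  commute : ∀ k → σ (instVar d x k) ≡ instVar d′ (σ x) k
  commute zero    = refl
  commute (suc k) = h k

ren-inst-params : ∀ ρ σ χ {d x} → (∀ k → σ (d + k) ≡ d + ρ k)
                → ren σ (inst χ d x) ≡ inst (ren (ext ρ) χ) d (σ x)
ren-inst-params ρ σ χ {d} {x} h = begin
  ren σ (inst χ d x)                       ≡⟨ cong (ren σ) (inst≡ren χ d x) ⟩
  ren σ (ren (instVar d x) χ)              ≡⟨ ren-fusion commute χ ⟩
  ren (λ k → instVar d (σ x) (ext ρ k)) χ  ≡⟨ sym (ren-fusion (λ _ → refl) χ) ⟩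
  ren (instVar d (σ x)) (ren (ext ρ) χ)    ≡⟨ sym (inst≡ren (ren (ext ρ) χ) d (σ x)) ⟩
  inst (ren (ext ρ) χ) d (σ x)             ∎
  where
  open ≡-Reasoning
  commute : ∀ k → σ (instVar d x k) ≡ instVar d (σ x) (ext ρ k)
  commute zero    = refl
  commute (suc k) = h k

Bounded-ren : ∀ ρ {φ} → Bounded φ → Bounded (ren ρ φ)
Bounded-ren ρ ⊥b          = ⊥b
Bounded-ren ρ (∈b x y)    = ∈b (ρ x) (ρ y)
Bounded-ren ρ (≐b x y)    = ≐b (ρ x) (ρ y)
Bounded-ren ρ (∧b a b)    = ∧b (Bounded-ren ρ a) (Bounded-ren ρ b)
Bounded-ren ρ (∨b a b)    = ∨b (Bounded-ren ρ a) (Bounded-ren ρ b)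
Bounded-ren ρ (⇒b a b)    = ⇒b (Bounded-ren ρ a) (Bounded-ren ρ b)
Bounded-ren ρ (bAllb x b) = bAllb (ρ x) (Bounded-ren (ext ρ) b)
Bounded-ren ρ (bExb x b)  = bExb (ρ x) (Bounded-ren (ext ρ) b)

𝓔-ren : ∀ {Φ} → RenClosed Φ → RenClosed (𝓔 Φ)
𝓔-ren c ρ (base p)    = base (c ρ p)
𝓔-ren c ρ (∧e a b)    = ∧e (𝓔-ren c ρ a) (𝓔-ren c ρ b)
𝓔-ren c ρ (∨e a b)    = ∨e (𝓔-ren c ρ a) (𝓔-ren c ρ b)
𝓔-ren c ρ (bAlle x a) = bAlle (ρ x) (𝓔-ren c (ext ρ) a)
𝓔-ren c ρ (bExe x a)  = bExe (ρ x) (𝓔-ren c (ext ρ) a)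
𝓔-ren c ρ (∃e a)      = ∃e (𝓔-ren c (ext ρ) a)

𝓤-ren : ∀ {Φ Ψ} → RenClosed Φ → RenClosed Ψ → RenClosed (𝓤 Φ Ψ)
𝓤-ren c e ρ (base p)    = base (c ρ p)
𝓤-ren c e ρ (∧u a b)    = ∧u (𝓤-ren c e ρ a) (𝓤-ren c e ρ b)
𝓤-ren c e ρ (∨u a b)    = ∨u (𝓤-ren c e ρ a) (𝓤-ren c e ρ b)
𝓤-ren c e ρ (∀u a)      = ∀u (𝓤-ren c e (ext ρ) a)
𝓤-ren c e ρ (bAllu x a) = bAllu (ρ x) (𝓤-ren c e (ext ρ) a)
𝓤-ren c e ρ (bExu x a)  = bExu (ρ x) (𝓤-ren c e (ext ρ) a)
𝓤-ren c e ρ (⇒u p a)    = ⇒u (e ρ p) (𝓤-ren c e ρ a)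

𝓔ˢ-ren : ∀ n → RenClosed (𝓔ˢ n)
𝓤ˢ-ren : ∀ n → RenClosed (𝓤ˢ n)
𝓔ˢ-ren zero    = Bounded-ren
𝓔ˢ-ren (suc n) = 𝓔-ren (𝓤ˢ-ren n)
𝓤ˢ-ren zero    = Bounded-ren
𝓤ˢ-ren (suc n) = 𝓤-ren (𝓔ˢ-ren n) (𝓔ˢ-ren n)

Bounded⇒𝓔ˢ : ∀ n {φ} → Bounded φ → 𝓔ˢ n φ
Bounded⇒𝓤ˢ : ∀ n {φ} → Bounded φ → 𝓤ˢ n φ
Bounded⇒𝓔ˢ zero    b = b
Bounded⇒𝓔ˢ (suc n) b = base (Bounded⇒𝓤ˢ n b)
Bounded⇒𝓤ˢ zero    b = b
Bounded⇒𝓤ˢ (suc n) b = base (Bounded⇒𝓔ˢ n b)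

NoAx-ren : RenClosed NoAx
NoAx-ren ρ ()

𝓔ₙ-ren : ∀ n → RenClosed (𝓔ₙ n)
𝓔ₙ-ren n ρ (ψ , s , e) = ren ρ ψ , 𝓔ˢ-ren n ρ s , ⊢-ren NoAx-ren ρ (λ ()) e

ren-SetInd : ∀ ρ χ → ren ρ (SetInd χ) ≡ SetInd (ren (ext ρ) χ)
ren-SetInd ρ χ = cong₂ (λ A B → ∀' (bAll 0 A ⇒ B) ⇒ ∀' B)
  (ren-inst-params ρ (ext (ext ρ)) χ (λ _ → refl))
  (ren-inst-params ρ (ext ρ) χ (λ _ → refl))

SIE-ren : ∀ n → RenClosed (SIE n)
SIE-ren n ρ extensionality       = extensionality
SIE-ren n ρ pairing              = pairing
SIE-ren n ρ union                = union
SIE-ren n ρ intersection         = intersection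
SIE-ren n ρ vfin                 = vfin
SIE-ren n ρ (setInduction χ χ∈𝓔) =
  subst (SIE n) (sym (ren-SetInd ρ χ)) (setInduction (ren (ext ρ) χ) (𝓔ₙ-ren n (ext ρ) χ∈𝓔))

module DerivedRules {T : Fm → Set} (T-ren : RenClosed T) where

  hyp₀ : ∀ {Γ φ} → T ∣ φ ∷ Γ ⊢ φ
  hyp₀ = hyp (here refl)

  hyp₁ : ∀ {Γ φ ψ} → T ∣ ψ ∷ φ ∷ Γ ⊢ φ
  hyp₁ = hyp (there (here refl))

  ⊢-mono : ∀ {Γ Δ φ} → Γ ⊆ Δ → T ∣ Γ ⊢ φ → T ∣ Δ ⊢ φ
  ⊢-mono {φ = φ} h d =
    cast (ren-id (λ _ → refl) φ)
         (⊢-ren T-ren id (λ {χ} m → subst (_∈ _) (sym (ren-id (λ _ → refl) χ)) (h m)) d)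

  ⊢-weaken : ∀ {Γ φ ψ} → T ∣ Γ ⊢ φ → T ∣ ψ ∷ Γ ⊢ φ
  ⊢-weaken = ⊢-mono there

  ⊢-from-[] : ∀ {Γ φ} → T ∣ [] ⊢ φ → T ∣ Γ ⊢ φ
  ⊢-from-[] = ⊢-mono (λ ())

  ⊢-shift : ∀ {Γ φ ψ} → T ∣ Γ ⊢ φ → T ∣ ψ ∷ map wk Γ ⊢ wk φ
  ⊢-shift = ⊢-ren T-ren suc (λ m → there (∈-map⁺ wk m))

  bAllI : ∀ {Γ x φ} → T ∣ (0 ∈' suc x) ∷ map wk Γ ⊢ φ → T ∣ Γ ⊢ bAll x φ
  bAllI d = ∀I (⇒I d)

  bAllE : ∀ {Γ x y φ} → T ∣ Γ ⊢ bAll x φ → T ∣ Γ ⊢ y ∈' x → T ∣ Γ ⊢ φ [ y ]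
  bAllE d m = ⇒E (∀E d _) m

  ≐-sym : ∀ {Γ x y} → T ∣ Γ ⊢ x ≐ y → T ∣ Γ ⊢ y ≐ x
  ≐-sym {x = x} e = ≐subst {φ = 0 ≐ suc x} e (≐refl x)

  ≐-∈ˡ : ∀ {Γ x y z} → T ∣ Γ ⊢ x ≐ y → T ∣ Γ ⊢ x ∈' z → T ∣ Γ ⊢ y ∈' z
  ≐-∈ˡ {z = z} e d = ≐subst {φ = 0 ∈' suc z} e d

  ∧-monoʳ : ∀ {φ ψ ψ′} → T ∣ [] ⊢ ψ ⇒ ψ′ → T ∣ [] ⊢ φ ∧' ψ ⇒ φ ∧' ψ′
  ∧-monoʳ e = ⇒I (∧I (∧E₁ hyp₀) (⇒E (⊢-from-[] e) (∧E₂ hyp₀)))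

  ∃-mono : ∀ {φ ψ} → T ∣ [] ⊢ φ ⇒ ψ → T ∣ [] ⊢ ∃' φ ⇒ ∃' ψ
  ∃-mono {ψ = ψ} e = ⇒I (∃E hyp₀ (∃I 0 (cast (sym (ext-wk-[0] ψ)) (⇒E (⊢-from-[] e) hyp₀))))

  bAll-mono : ∀ {x φ ψ} → T ∣ [] ⊢ φ ⇒ ψ → T ∣ [] ⊢ bAll x φ ⇒ bAll x ψ
  bAll-mono {φ = φ} e = ⇒I (bAllI (⇒E (⊢-from-[] e) (cast (ext-wk-[0] φ) (bAllE hyp₁ hyp₀))))

-- ∃s (x ∩ a ⊆ s ∧ s ⊆ X) instead of ∀y∈x (y ∈ a → X y): 𝓔ₙ is not closed under
-- implication, but this form is in 𝓔ₙ whenever X is.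
∩⊆Class : Fm → ℕ → ℕ → ℕ → Fm
∩⊆Class φ d x a = ∃' (bAll (suc x) (0 ∈' suc (suc a) ⇒ 0 ∈' 1) ∧' bAll 0 (inst φ (suc (suc d)) 0))

ren-∩⊆Class : ∀ σ φ {d d′} x a → (∀ k → σ (d + k) ≡ d′ + k)
            → ren σ (∩⊆Class φ d x a) ≡ ∩⊆Class φ d′ (σ x) (σ a)
ren-∩⊆Class σ φ x a h =
  cong (λ A → ∃' (bAll (suc (σ x)) (0 ∈' suc (suc (σ a)) ⇒ 0 ∈' 1) ∧' bAll 0 A))
       (ren-inst (ext (ext σ)) φ (λ k → cong (λ m → suc (suc m)) (h k)))

𝓔ₙ-∩⊆Class : ∀ m φ d x a → 𝓔ₙ (suc m) φ → 𝓔ₙ (suc m) (∩⊆Class φ d x a)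
𝓔ₙ-∩⊆Class m φ d x a (ψ , ψ∈𝓔 , φ⇔ψ) =
  ∩⊆Class ψ d x a , 𝓔-syntax , ∧I (lift (∧E₁ instφ⇔instψ)) (lift (∧E₂ instφ⇔instψ))
  where
  open DerivedRules NoAx-ren
  instφ⇔instψ : NoAx ∣ [] ⊢ inst φ (suc (suc d)) 0 ⇔ inst ψ (suc (suc d)) 0
  instφ⇔instψ = cast (cong₂ _⇔_ (sym (inst≡ren φ _ 0)) (sym (inst≡ren ψ _ 0)))
                     (⊢-ren NoAx-ren (instVar (suc (suc d)) 0) (λ ()) φ⇔ψ)
  x∩a⊆0 : Fm
  x∩a⊆0 = bAll (suc x) (0 ∈' suc (suc a) ⇒ 0 ∈' 1)
  lift : ∀ {A B} → NoAx ∣ [] ⊢ A ⇒ B → NoAx ∣ [] ⊢ ∃' (x∩a⊆0 ∧' bAll 0 A) ⇒ ∃' (x∩a⊆0 ∧' bAll 0 B)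
  lift e = ∃-mono (∧-monoʳ (bAll-mono e))
  𝓔-syntax : 𝓔ˢ (suc m) (∩⊆Class ψ d x a)
  𝓔-syntax = ∃e (∧e (base (Bounded⇒𝓤ˢ m (bAllb (suc x) (⇒b (∈b 0 _) (∈b 0 1)))))
                    (bAlle 0 (subst (𝓔ˢ (suc m)) (sym (inst≡ren ψ _ 0)) (𝓔ˢ-ren (suc m) _ ψ∈𝓔))))

module Extensionality (n : ℕ) where
  open DerivedRules (SIE-ren n)

  ≐-ext : ∀ {Γ b c} → SIE n ∣ Γ ⊢ b ⊆' c → SIE n ∣ Γ ⊢ c ⊆' b → SIE n ∣ Γ ⊢ b ≐ c
  ≐-ext {b = b} {c} b⊆c c⊆b = ⇒E (∀E (∀E (ax extensionality) b) c) (∧I b⊆c c⊆b)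

  empty-⊆ : ∀ {Γ b c} → SIE n ∣ Γ ⊢ isEmpty b → SIE n ∣ Γ ⊢ b ⊆' c
  empty-⊆ b-empty = bAllI (⊥E (bAllE (⊢-shift b-empty) hyp₀))

  empty-unique : ∀ {Γ b c} → SIE n ∣ Γ ⊢ isEmpty b → SIE n ∣ Γ ⊢ isEmpty c → SIE n ∣ Γ ⊢ b ≐ c
  empty-unique b-empty c-empty = ≐-ext (empty-⊆ b-empty) (empty-⊆ c-empty)

  succ-⊆ : ∀ {Γ b c g} → SIE n ∣ Γ ⊢ isSuccOf b g → SIE n ∣ Γ ⊢ isSuccOf c g → SIE n ∣ Γ ⊢ b ⊆' c
  succ-⊆ b-succ c-succ = bAllI (∨E (bAllE (∧E₁ (⊢-shift b-succ)) hyp₀)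
    (bAllE (∧E₁ (∧E₂ (⊢-weaken (⊢-shift c-succ)))) hyp₀)
    (≐-∈ˡ (≐-sym hyp₀) (∧E₂ (∧E₂ (⊢-weaken (⊢-shift c-succ))))))

  succ-unique : ∀ {Γ b c g} → SIE n ∣ Γ ⊢ isSuccOf b g → SIE n ∣ Γ ⊢ isSuccOf c g → SIE n ∣ Γ ⊢ b ≐ c
  succ-unique b-succ c-succ = ≐-ext (succ-⊆ b-succ c-succ) (succ-⊆ c-succ b-succ)

module ClassReasoning (n : ℕ) (φ : Fm) where
  open DerivedRules (SIE-ren n)
  open Extensionality n

  X : ℕ → ℕ → Fm
  X = inst φ

  ∅∈X SuccClosed Ind-at : ℕ → Fm
  ∅∈X d        = ∃' (isEmpty 0 ∧' X (suc d) 0)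
  SuccClosed d = ∀' (X (suc d) 0 ⇒ ∃' (isSuccOf 0 1 ∧' X (suc (suc d)) 0))
  Ind-at d     = ∅∈X d ∧' SuccClosed d

  ∩⊆X : ℕ → ℕ → ℕ → Fm
  ∩⊆X = ∩⊆Class φ

  wk-X : ∀ d x → wk (X d x) ≡ X (suc d) (suc x)
  wk-X d x = ren-inst suc φ (λ _ → refl)

  X-[] : ∀ d x → X (suc d) 0 [ x ] ≡ X d x
  X-[] d x = ren-inst (sub0 x) φ (λ _ → refl)

  wk-Ind-at : ∀ d → wk (Ind-at d) ≡ Ind-at (suc d)
  wk-Ind-at d = cong₂ (λ A B → ∃' (isEmpty 0 ∧' A) ∧' ∀' (A ⇒ ∃' (isSuccOf 0 1 ∧' B)))
    (ren-inst (ext suc) φ (λ _ → refl))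
    (ren-inst (ext (ext suc)) φ (λ _ → refl))

  wk-∩⊆X : ∀ d x a → wk (∩⊆X d x a) ≡ ∩⊆X (suc d) (suc x) (suc a)
  wk-∩⊆X d x a = ren-∩⊆Class suc φ x a (λ _ → refl)

  ⊢-shift-Ind-at : ∀ {Γ d ψ} → SIE n ∣ Γ ⊢ Ind-at d → SIE n ∣ ψ ∷ map wk Γ ⊢ Ind-at (suc d)
  ⊢-shift-Ind-at {d = d} ind = cast (wk-Ind-at d) (⊢-shift ind)

  X-≐ : ∀ {Γ d x y} → SIE n ∣ Γ ⊢ x ≐ y → SIE n ∣ Γ ⊢ X d x → SIE n ∣ Γ ⊢ X d y
  X-≐ {d = d} {x} {y} e x∈X = cast (X-[] d y) (≐subst {φ = X (suc d) 0} e (cast (sym (X-[] d x)) x∈X))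

  empty⇒∈X : ∀ {Γ d y} → SIE n ∣ Γ ⊢ ∅∈X d → SIE n ∣ Γ ⊢ isEmpty y → SIE n ∣ Γ ⊢ X d y
  empty⇒∈X {d = d} {y} ∅-in y-empty =
    ∃E ∅-in (cast (sym (wk-X d y)) (X-≐ (empty-unique (∧E₁ hyp₀) (⊢-shift y-empty)) (∧E₂ hyp₀)))

  succ⇒∈X : ∀ {Γ d y g} → SIE n ∣ Γ ⊢ SuccClosed d → SIE n ∣ Γ ⊢ isSuccOf y g
          → SIE n ∣ Γ ⊢ X d g → SIE n ∣ Γ ⊢ X d y
  succ⇒∈X {d = d} {y} {g} closed y-succ g∈X =
    ∃E (⇒E (cast SuccClosed-[] (∀E closed g)) g∈X)
       (cast (sym (wk-X d y)) (X-≐ (succ-unique (∧E₁ hyp₀) (⊢-shift y-succ)) (∧E₂ hyp₀)))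
    where
    SuccClosed-[] : (X (suc d) 0 ⇒ ∃' (isSuccOf 0 1 ∧' X (suc (suc d)) 0)) [ g ]
                  ≡ (X d g ⇒ ∃' (isSuccOf 0 (suc g) ∧' X (suc d) 0))
    SuccClosed-[] = cong₂ (λ A B → A ⇒ ∃' (isSuccOf 0 (suc g) ∧' B))
      (X-[] d g) (ren-inst (ext (sub0 g)) φ (λ _ → refl))

  ∩⊆X-elim : ∀ {Γ d x a g} → SIE n ∣ Γ ⊢ ∩⊆X d x a → SIE n ∣ Γ ⊢ g ∈' x → SIE n ∣ Γ ⊢ g ∈' a
           → SIE n ∣ Γ ⊢ X d g
  ∩⊆X-elim {d = d} {g = g} x∩a⊆X g∈x g∈a =
    ∃E x∩a⊆X (cast (trans (X-[] (suc d) (suc g)) (sym (wk-X d g)))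
      (bAllE (∧E₂ hyp₀) (⇒E (bAllE (∧E₁ hyp₀) (⊢-shift g∈x)) (⊢-shift g∈a))))

  ∩⊆X-intro : ∀ {Γ d x a} → SIE n ∣ (0 ∈' suc x ∧' 0 ∈' suc a) ∷ map wk Γ ⊢ X (suc d) 0
            → SIE n ∣ Γ ⊢ ∩⊆X d x a
  ∩⊆X-intro {Γ} {d} {x} {a} y∈X =
    ∃E (∀E (∀E (ax intersection) x) a)
       (cast (sym (wk-∩⊆X d x a)) (∃I 0 (cast (sym witness-[0]) (∧I x∩a⊆s s⊆X))))
    where
    s-is-x∩a : Fm
    s-is-x∩a = ∀' (0 ∈' 1 ⇔ (0 ∈' suc (suc x) ∧' 0 ∈' suc (suc a)))
    witness-[0] : (bAll (suc (suc x)) (0 ∈' suc (suc (suc a)) ⇒ 0 ∈' 1) ∧' bAll 0 (X (suc (suc (suc d))) 0)) [ 0 ]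
                ≡ bAll (suc x) (0 ∈' suc (suc a) ⇒ 0 ∈' 1) ∧' bAll 0 (X (suc (suc d)) 0)
    witness-[0] = cong (λ A → bAll (suc x) (0 ∈' suc (suc a) ⇒ 0 ∈' 1) ∧' bAll 0 A)
      (ren-inst (ext (sub0 0)) φ (λ _ → refl))
    x∩a⊆s : SIE n ∣ s-is-x∩a ∷ map wk Γ ⊢ bAll (suc x) (0 ∈' suc (suc a) ⇒ 0 ∈' 1)
    x∩a⊆s = bAllI (⇒I (⇒E (∧E₂ (∀E (⊢-weaken (⊢-shift hyp₀)) 0)) (∧I hyp₁ hyp₀)))
    skip-s : ((0 ∈' suc x ∧' 0 ∈' suc a) ∷ map wk Γ)
             ⊆⟨ ext suc ⟩ ((0 ∈' suc (suc x) ∧' 0 ∈' suc (suc a)) ∷ (0 ∈' 1) ∷ map wk (s-is-x∩a ∷ map wk Γ))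
    skip-s = ⊆⟨⟩-∷ (λ m → there (⊆⟨⟩-wk (λ m′ → there (∈-map⁺ wk m′)) m))
    s⊆X : SIE n ∣ s-is-x∩a ∷ map wk Γ ⊢ bAll 0 (X (suc (suc d)) 0)
    s⊆X = bAllI (⇒E (⇒I (cast (ren-inst (ext suc) φ (λ _ → refl)) (⊢-ren (SIE-ren n) (ext suc) skip-s y∈X)))
                    (⇒E (∧E₁ (∀E (⊢-shift hyp₀) 0)) hyp₀))

  emptyOrSucc⇒∈X : ∀ {Γ d y a} → SIE n ∣ Γ ⊢ Ind-at d → SIE n ∣ Γ ⊢ y ⊆' a → SIE n ∣ Γ ⊢ ∩⊆X d y a
                 → SIE n ∣ Γ ⊢ emptyOrSucc y → SIE n ∣ Γ ⊢ X d y
  emptyOrSucc⇒∈X {d = d} {y} {a} ind y⊆a y∩a⊆X y-eos =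
    ∨E y-eos (empty⇒∈X (∧E₁ (⊢-weaken ind)) hyp₀)
      (∃E hyp₀ (cast (sym (wk-X d y))
        (succ⇒∈X (∧E₂ (⊢-shift-Ind-at (⊢-weaken ind))) (∧E₂ hyp₀)
          (∩⊆X-elim (cast (wk-∩⊆X d y a) (⊢-shift (⊢-weaken y∩a⊆X))) γ∈y
                    (bAllE (⊢-shift (⊢-weaken y⊆a)) γ∈y)))))
    where
    γ∈y : ∀ {Δ} → SIE n ∣ (isOrd 0 ∧' isSuccOf (suc y) 0) ∷ Δ ⊢ 0 ∈' suc y
    γ∈y = ∧E₂ (∧E₂ (∧E₂ hyp₀))

  ∩⊆X-step : ∀ {Γ d x a} → SIE n ∣ Γ ⊢ Ind-at d → SIE n ∣ Γ ⊢ isTrans a → SIE n ∣ Γ ⊢ bAll a (emptyOrSucc 0)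
           → SIE n ∣ Γ ⊢ bAll x (∩⊆X (suc d) 0 (suc a)) → SIE n ∣ Γ ⊢ ∩⊆X d x a
  ∩⊆X-step {Γ} {d} {x} {a} ind a-trans a-eos ih = ∩⊆X-intro
    (emptyOrSucc⇒∈X (⊢-shift-Ind-at ind) (bAllE (⊢-shift a-trans) y∈a) y∩a⊆X (bAllE (⊢-shift a-eos) y∈a))
    where
    y∈a : ∀ {Δ} → SIE n ∣ (0 ∈' suc x ∧' 0 ∈' suc a) ∷ Δ ⊢ 0 ∈' suc a
    y∈a = ∧E₂ hyp₀
    y∩a⊆X : SIE n ∣ (0 ∈' suc x ∧' 0 ∈' suc a) ∷ map wk Γ ⊢ ∩⊆X (suc d) 0 (suc a)
    y∩a⊆X = cast (ren-∩⊆Class (sub0 0) φ 0 (suc (suc a)) (λ _ → refl))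
      (bAllE (cast (cong (bAll (suc x)) (ren-∩⊆Class (ext suc) φ 0 (suc a) (λ _ → refl))) (⊢-shift ih))
             (∧E₁ hyp₀))

  SetInd-∩⊆X : SetInd (∩⊆X 2 0 1) ≡ (∀' (bAll 0 (∩⊆X 3 0 2) ⇒ ∩⊆X 2 0 1) ⇒ ∀' (∩⊆X 2 0 1))
  SetInd-∩⊆X = cong₂ (λ A B → ∀' (bAll 0 A ⇒ B) ⇒ ∀' B)
    (inst-∩⊆X 2 (λ _ → refl)) (inst-∩⊆X 1 (λ _ → refl))
    where
    inst-∩⊆X : ∀ d {d′} → (∀ k → instVar d 0 (2 + k) ≡ d′ + k)
             → inst (∩⊆X 2 0 1) d 0 ≡ ∩⊆X d′ 0 (instVar d 0 1)
    inst-∩⊆X d h = trans (inst≡ren (∩⊆X 2 0 1) d 0) (ren-∩⊆Class (instVar d 0) φ 0 1 h)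

  -- ∩⊆X 2 0 1 is the class {x | x ∩ a ⊆ X}, with a as its first parameter.
  Ind⇒ω⊆X : 𝓔ₙ n (∩⊆X 2 0 1) → SIE n ∣ [] ⊢ Ind φ ⇒ ωSub φ
  Ind⇒ω⊆X χ∈𝓔 = ⇒I (∀I (⇒I (emptyOrSucc⇒∈X ind (bAllI hyp₀) a∩a⊆X (∧E₂ (∧E₂ hyp₀)))))
    where
    Γa : List Fm
    Γa = inω 0 ∷ map wk (Ind φ ∷ [])
    ind : SIE n ∣ Γa ⊢ Ind-at 1
    ind = cast (wk-Ind-at 0) hyp₁
    step : SIE n ∣ bAll 0 (∩⊆X 3 0 2) ∷ map wk Γa ⊢ ∩⊆X 2 0 1
    step = ∩⊆X-step (⊢-shift-Ind-at ind) (⊢-shift (∧E₁ (∧E₁ hyp₀))) (⊢-shift (∧E₁ (∧E₂ hyp₀))) hyp₀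
    a∩a⊆X : SIE n ∣ Γa ⊢ ∩⊆X 1 0 0
    a∩a⊆X = cast (ren-∩⊆Class (sub0 0) φ 0 1 (λ _ → refl))
      (∀E (⇒E (cast SetInd-∩⊆X (ax (setInduction (∩⊆X 2 0 1) χ∈𝓔))) (∀I (⇒I step))) 0)

mainTheorem16 : (n : ℕ) → 1 ≤ n → (φ : Fm) → 𝓔ₙ n φ → SIE n ∣ [] ⊢ Ind φ ⇒ ωSub φ
mainTheorem16 (suc m) _ φ φ∈𝓔 = ClassReasoning.Ind⇒ω⊆X (suc m) φ (𝓔ₙ-∩⊆Class m φ 2 0 1 φ∈𝓔)
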